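{- Let $(G,c)$ be a bicolored graph with vertex set $[n]$ such that $1,2,\dots,n$ is a successful pressing sequence, let $A=A(G)$, and let $A=LL^T$ with $L$ an invertible lower-triangular matrix over $\mathbb{F}_2$. Let $\sigma$ be a permutation of $[n]$ and $P$ the permutation matrix encoding $\sigma$, so that $(PAP^T)_{i,j}=A_{\sigma(i),\sigma(j)}$. Then the following are equivalent: (i) $\sigma(1),\dots,\sigma(n)$ is a successful pressing sequence of $(G,c)$; (ii) the all-ones vector $\hat 1$ is a left eigenvector of $\psi(L^TP^T)$ with eigenvalue $1$, i.e., $\hat 1^T\psi(L^TP^T)=\hat 1^T$; (iii) $\psi(L^TP^T)$ is orthogonal.
   Context: A bicolored graph is a pair $(G,c)$ with $G$ a finite simple graph and $c:V(G)\to\{\text{black},\text{white}\}$. The augmented adjacency matrix $A(G)\in\mathbb{F}_2^{n\times n}$ is the adjacency matrix of $G$ with diagonal entry $1$ at black and $0$ at white vertices. Pressing a black vertex $v$ complements the induced subgraph on the closed neighborhood $N^\ast(v)=N(v)\cup\{v\}$ and flips the color of each vertex of $N^\ast(v)$, leaving everything else unchanged. A pressing sequence is a sequence of vertices each black at the moment it is pressed; it is successful if the final graph has no edges and all vertices white. A matrix $Q$ over $\mathbb{F}_2$ is orthogonal if $Q^TQ=I$. For an $n\times n$ matrix $B$ over $\mathbb{F}_2$ with columns $b_1,\dots,b_n$, $\psi(B)$ is the matrix with columns $b'_1,\dots,b'_n$ defined recursively by $b'_1=b_1$ and $b'_{k+1}=b_{k+1}+\sum_{j=1}^{k} b'_j\,(b'_j\cdot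 b_{k+1})$, where $\cdot$ is the standard dot product over $\mathbb{F}_2$ (unnormalized Gram–Schmidt). -}

module Defs where

open import Data.Nat using (ℕ; zero; suc; _<_)
open import Data.Bool using (Bool; true; false; _∧_; _∨_; _xor_; not; if_then_else_)
open import Data.Fin using (Fin; toℕ; _≟_)
open import Data.Fin.Permutation using (Permutation′; _⟨$⟩ʳ_)
open import Data.List using (List; []; _∷_; map; allFin)
open import Data.Vec using (Vec; []; _∷_; lookup; tabulate)
open import Data.Product using (_×_; Σ)
open import Relation.Nullary.Decidable using (⌊_⌋)
open import Relation.Binary.PropositionalEquality using (_≡_)

-- Linear algebra over F₂ = Bool (addition = xor, multiplication = ∧)

V : ℕ → Set
V n = Fin n → Bool

Mat : ℕ → Set
Mat n = Fin n → Fin n → Bool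

Σ₂ : ∀ {n} → (Fin n → Bool) → Bool
Σ₂ {zero}  f = false
Σ₂ {suc n} f = f Fin.zero xor Σ₂ (λ i → f (Fin.suc i))

_·_ : ∀ {n} → V n → V n → Bool
u · v = Σ₂ (λ i → u i ∧ v i)

_⊕_ : ∀ {n} → V n → V n → V n
(u ⊕ v) i = u i xor v i

_*M_ : ∀ {n} → Mat n → Mat n → Mat n
(A *M B) i j = Σ₂ (λ k → A i k ∧ B k j)

_ᵀ : ∀ {n} → Mat n → Mat n
(A ᵀ) i j = A j i

_==_ : ∀ {n} → Fin n → Fin n → Bool
i == j = ⌊ i ≟ j ⌋

I : ∀ {n} → Mat n
I i j = i == j

_≈M_ : ∀ {n} → Mat n → Mat n → Set
A ≈M B = ∀ i j → A i j ≡ B i j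

LowerTriangular : ∀ {n} → Mat n → Set
LowerTriangular L = ∀ i j → toℕ i < toℕ j → L i j ≡ false

Invertible : ∀ {n} → Mat n → Set
Invertible {n} L = Σ (Mat n) (λ M → ((L *M M) ≈M I) × ((M *M L) ≈M I))

Orthogonal : ∀ {n} → Mat n → Set
Orthogonal Q = ((Q ᵀ) *M Q) ≈M I

-- 1̂ᵀ Q = 1̂ᵀ   (all-ones vector is a left eigenvector with eigenvalue 1)
OnesLeftEigen : ∀ {n} → Mat n → Set
OnesLeftEigen Q = ∀ j → Σ₂ (λ i → Q i j) ≡ true

-- permutation matrix encoding σ : P i j = 1 iff j = σ(i),
-- so that (P A Pᵀ) i j = A (σ i) (σ j)
permMat : ∀ {n} → Permutation′ n → Mat n
permMat σ i j = (σ ⟨$⟩ʳ i) == j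

-- Unnormalised Gram–Schmidt ψ

gsStep : ∀ {n} → List (V n) → V n → V n
gsStep []         b = b
gsStep (p ∷ prev) b i = (p i ∧ (p · b)) xor gsStep prev b i

gsGo : ∀ {n m} → List (V n) → Vec (V n) m → Vec (V n) m
gsGo acc []       = []
gsGo acc (b ∷ bs) = let b' = gsStep acc b in b' ∷ gsGo (b' ∷ acc) bs

ψ : ∀ {n} → Mat n → Mat n
ψ {n} B i k = lookup (gsGo [] (tabulate (λ k i → B i k))) k i

-- Bicolored graphs on vertex set Fin n (colour true = black)

record BGraph (n : ℕ) : Set where
  constructor bg
  field
    adj   : Fin n → Fin n → Bool
    black : Fin n → Bool
open BGraph public

Simple : ∀ {n} → BGraph n → Set
Simple G = (∀ i j → adj G i j ≡ adj G j i) × (∀ i → adj G i i ≡ false)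

augAdj : ∀ {n} → BGraph n → Mat n
augAdj G i j = if i == j then black G i else adj G i j

inN* : ∀ {n} → BGraph n → Fin n → Fin n → Bool
inN* G v i = (i == v) ∨ adj G v i

press : ∀ {n} → Fin n → BGraph n → BGraph n
press v G = bg
  (λ i j → adj G i j xor (inN* G v i ∧ inN* G v j ∧ not (i == j)))
  (λ i → black G i xor inN* G v i)

SuccessfulPressing : ∀ {n} → BGraph n → List (Fin n) → Set
SuccessfulPressing G [] = (∀ i j → adj G i j ≡ false) × (∀ i → black G i ≡ false)
SuccessfulPressing G (v ∷ s) = (black G v ≡ true) × SuccessfulPressing (press v G) s

module Submission where

-- Idea: pressing sequences are Gram–Schmidt runs.  With w u = row u of L,
-- A(G) is the Gram matrix (w i · w j).  Pressing a black vertex v is the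
-- rank-one update A ↦ A + a_v a_vᵀ (§4), and appending the residual p of v
-- (w v minus its components along the earlier Gram–Schmidt outputs) to the
-- outputs performs the same update on the Gram matrix of the residuals (§1,
-- §2); v is black iff p · p = 1.  So, for an order σ(1), …, σ(n) covering
-- all vertices, pressing succeeds iff Gram–Schmidt on w σ(1), …, w σ(n)
-- outputs only unit vectors (§5).  These are the columns of Lᵀ Pᵀ, and for
-- ψ of any matrix "all columns are unit vectors" is equivalent both to
-- 1̂ᵀ ψ = 1̂ᵀ (x · x is the entry sum of x) and to orthogonality (§3); the
-- theorem follows (§6).

open import Defs
open import Data.Nat using (ℕ; zero; suc)
open import Data.Bool using (Bool; true; false; _∧_; _∨_; _xor_; not; if_then_else_)
open import Data.Bool.Properties
  using (∧-comm; ∧-assoc; ∧-idem; ∧-identityʳ; ∧-zeroʳ; xor-comm; xor-same; xor-identityʳ;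
         ∧-distribˡ-xor; xor-∧-commutativeRing)
open import Data.Bool.Solver using (module xor-∧-Solver)
open import Algebra.Bundles using (CommutativeRing)
open import Algebra.Properties.Semiring.Sum (CommutativeRing.semiring xor-∧-commutativeRing)
  using (sum; sum-cong-≗; ∑-distrib-+; *-distribˡ-sum)
open import Data.Fin using (Fin; zero; suc; _≟_)
open import Data.Fin.Properties using (suc-injective)
open import Data.Fin.Permutation using (Permutation′; _⟨$⟩ʳ_; _⟨$⟩ˡ_; inverseʳ)
open import Data.List using (List; []; _∷_; map; allFin)
import Data.List as List
open import Data.List.Properties using (map-tabulate)
open import Data.List.Relation.Unary.All using (All; []; _∷_)
import Data.List.Relation.Unary.All as All
open import Data.List.Relation.Unary.Any using (here; there)
open import Data.List.Membership.Propositional using (_∈_)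
open import Data.List.Membership.Propositional.Properties using (∈-map⁺; ∈-allFin)
open import Data.Vec using (Vec; []; _∷_; lookup; tabulate)
open import Data.Vec.Relation.Unary.All as VecAll using ([]; _∷_)
open import Data.Vec.Relation.Unary.All.Properties using (lookup⁺; lookup⁻)
open import Data.Product using (_×_; _,_)
open import Data.Sum using (_⊎_; inj₁; inj₂)
open import Data.Unit using (⊤; tt)
open import Function using (_∘_)
open import Function.Bundles using (_⇔_; mk⇔; Equivalence)
import Function.Properties.Equivalence as ⇔
open import Relation.Nullary using (¬_; yes; no)
open import Relation.Nullary.Decidable using (isYes≗does; dec-true; dec-false)
open import Relation.Binary.PropositionalEquality

open ≡-Reasoning

-- §1  Sums and dot products over F₂

-- Σ₂ is the library sum of the commutative ring (Bool, xor, ∧); this lets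
-- us reuse the library's linearity lemmas for finite sums.
Σ₂≡sum : ∀ {n} (f : Fin n → Bool) → Σ₂ f ≡ sum f
Σ₂≡sum {zero}  f = refl
Σ₂≡sum {suc n} f = cong (f zero xor_) (Σ₂≡sum (f ∘ suc))

Σ₂-cong : ∀ {n} {f g : Fin n → Bool} → f ≗ g → Σ₂ f ≡ Σ₂ g
Σ₂-cong {f = f} {g} f≗g =
  trans (Σ₂≡sum f) (trans (sum-cong-≗ f≗g) (sym (Σ₂≡sum g)))

Σ₂-xor : ∀ {n} (f g : Fin n → Bool) → Σ₂ (λ i → f i xor g i) ≡ Σ₂ f xor Σ₂ g
Σ₂-xor f g = begin
  Σ₂ (λ i → f i xor g i)  ≡⟨ Σ₂≡sum (λ i → f i xor g i) ⟩
  sum (λ i → f i xor g i) ≡⟨ ∑-distrib-+ f g ⟩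
  sum f xor sum g         ≡⟨ sym (cong₂ _xor_ (Σ₂≡sum f) (Σ₂≡sum g)) ⟩
  Σ₂ f xor Σ₂ g           ∎

Σ₂-scale : ∀ {n} (c : Bool) (f : Fin n → Bool) → Σ₂ (λ i → c ∧ f i) ≡ c ∧ Σ₂ f
Σ₂-scale c f = begin
  Σ₂ (λ i → c ∧ f i)  ≡⟨ Σ₂≡sum (λ i → c ∧ f i) ⟩
  sum (λ i → c ∧ f i) ≡⟨ sym (*-distribˡ-sum c f) ⟩
  c ∧ sum f           ≡⟨ cong (c ∧_) (sym (Σ₂≡sum f)) ⟩
  c ∧ Σ₂ f            ∎

Σ₂-false : ∀ {n} {f : Fin n → Bool} → (∀ i → f i ≡ false) → Σ₂ f ≡ false
Σ₂-false {zero}  vanish = refl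
Σ₂-false {suc n} vanish = cong₂ _xor_ (vanish zero) (Σ₂-false (vanish ∘ suc))

Σ₂-single : ∀ {n} (f : Fin n → Bool) (a : Fin n) → (∀ i → ¬ i ≡ a → f i ≡ false) →
  Σ₂ f ≡ f a
Σ₂-single {suc n} f zero vanish = begin
  f zero xor Σ₂ (f ∘ suc) ≡⟨ cong (f zero xor_) (Σ₂-false (λ i → vanish (suc i) λ ())) ⟩
  f zero xor false        ≡⟨ xor-identityʳ (f zero) ⟩
  f zero                  ∎
Σ₂-single {suc n} f (suc a) vanish =
  cong₂ _xor_ (vanish zero λ ()) (Σ₂-single (f ∘ suc) a (λ i i≢a → vanish (suc i) (i≢a ∘ suc-injective)))

==-refl : ∀ {n} (i : Fin n) → (i == i) ≡ true
==-refl i = trans (isYes≗does (i ≟ i)) (dec-true (i ≟ i) refl)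

==-≢ : ∀ {n} {i j : Fin n} → ¬ i ≡ j → (i == j) ≡ false
==-≢ {i = i} {j} i≢j = trans (isYes≗does (i ≟ j)) (dec-false (i ≟ j) i≢j)

==-suc : ∀ {n} (i j : Fin n) → (suc i == suc j) ≡ (i == j)
==-suc i j with i ≟ j
... | yes _ = refl
... | no _  = refl

by-diagonal : ∀ {n} {P : Fin n → Fin n → Set} →
  (∀ i → P i i) → (∀ {i j} → ¬ i ≡ j → P i j) → ∀ i j → P i j
by-diagonal on-diagonal off-diagonal i j with i ≟ j
... | yes refl = on-diagonal i
... | no i≢j   = off-diagonal i≢j

Σ₂-select : ∀ {n} (f : Fin n → Bool) (a : Fin n) → Σ₂ (λ l → f l ∧ (a == l)) ≡ f a
Σ₂-select f a =
  trans (Σ₂-single _ a (λ l l≢a → trans (cong (f l ∧_) (==-≢ (l≢a ∘ sym))) (∧-zeroʳ (f l))))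
        (trans (cong (f a ∧_) (==-refl a)) (∧-identityʳ (f a)))

_*V_ : ∀ {d} → Bool → V d → V d
(a *V p) x = p x ∧ a

𝟘 : ∀ {d} → V d
𝟘 _ = false

_⊥_ : ∀ {d} → V d → V d → Set
u ⊥ v = u · v ≡ false

Unit : ∀ {d} → V d → Set
Unit u = u · u ≡ true

·-cong : ∀ {d} {u u' v v' : V d} → u ≗ u' → v ≗ v' → u · v ≡ u' · v'
·-cong u≗u' v≗v' = Σ₂-cong (λ i → cong₂ _∧_ (u≗u' i) (v≗v' i))

·-comm : ∀ {d} (u v : V d) → u · v ≡ v · u
·-comm u v = Σ₂-cong (λ i → ∧-comm (u i) (v i))

⊥-sym : ∀ {d} (u v : V d) → u ⊥ v → v ⊥ u
⊥-sym u v u⊥v = trans (·-comm v u) u⊥v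

·-⊕ʳ : ∀ {d} (u v w : V d) → u · (v ⊕ w) ≡ (u · v) xor (u · w)
·-⊕ʳ u v w = trans (Σ₂-cong (λ i → ∧-distribˡ-xor (u i) (v i) (w i))) (Σ₂-xor (λ i → u i ∧ v i) (λ i → u i ∧ w i))

·-*ʳ : ∀ {d} (u : V d) (a : Bool) (v : V d) → u · (a *V v) ≡ a ∧ (u · v)
·-*ʳ u a v =
  trans (Σ₂-cong (λ i → trans (sym (∧-assoc (u i) (v i) a)) (∧-comm (u i ∧ v i) a)))
        (Σ₂-scale a (λ i → u i ∧ v i))

·-zeroʳ : ∀ {d} (u : V d) {z : V d} → z ≗ 𝟘 → u · z ≡ false
·-zeroʳ u z≗𝟘 = Σ₂-false (λ i → trans (cong (u i ∧_) (z≗𝟘 i)) (∧-zeroʳ (u i)))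

-- Over F₂ we have x ∧ x = x, so the self dot product is the entry sum.
·-self : ∀ {d} (u : V d) → u · u ≡ Σ₂ u
·-self u = Σ₂-cong (λ i → ∧-idem (u i))

·-shiftˡ : ∀ {d} (a : Bool) (p x y : V d) → ((a *V p) ⊕ x) · y ≡ (a ∧ (p · y)) xor (x · y)
·-shiftˡ a p x y = begin
  ((a *V p) ⊕ x) · y              ≡⟨ ·-comm _ y ⟩
  y · ((a *V p) ⊕ x)              ≡⟨ ·-⊕ʳ y (a *V p) x ⟩
  (y · (a *V p)) xor (y · x)      ≡⟨ cong₂ _xor_ (·-*ʳ y a p) (·-comm y x) ⟩
  (a ∧ (y · p)) xor (x · y)       ≡⟨ cong (λ t → (a ∧ t) xor (x · y)) (·-comm y p) ⟩
  (a ∧ (p · y)) xor (x · y)       ∎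

·-rank-one : ∀ {d} (p x y : V d) {a b : Bool} → Unit p → x · p ≡ a → p · y ≡ b →
  ((a *V p) ⊕ x) · ((b *V p) ⊕ y) ≡ (a ∧ b) xor (x · y)
·-rank-one p x y {a} {b} p-unit x·p p·y = begin
  ((a *V p) ⊕ x) · ((b *V p) ⊕ y)
    ≡⟨ ·-shiftˡ a p x ((b *V p) ⊕ y) ⟩
  (a ∧ (p · ((b *V p) ⊕ y))) xor (x · ((b *V p) ⊕ y))
    ≡⟨ cong₂ (λ s t → (a ∧ s) xor t) (·-⊕ʳ p (b *V p) y) (·-⊕ʳ x (b *V p) y) ⟩
  (a ∧ ((p · (b *V p)) xor (p · y))) xor ((x · (b *V p)) xor (x · y))
    ≡⟨ cong₂ (λ s t → (a ∧ (s xor (p · y))) xor (t xor (x · y))) (·-*ʳ p b p) (·-*ʳ x b p) ⟩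
  (a ∧ ((b ∧ (p · p)) xor (p · y))) xor ((b ∧ (x · p)) xor (x · y))
    ≡⟨ cong₂ (λ s t → (a ∧ ((b ∧ s) xor t)) xor ((b ∧ (x · p)) xor (x · y))) p-unit p·y ⟩
  (a ∧ ((b ∧ true) xor b)) xor ((b ∧ (x · p)) xor (x · y))
    ≡⟨ cong (λ s → (a ∧ ((b ∧ true) xor b)) xor ((b ∧ s) xor (x · y))) x·p ⟩
  (a ∧ ((b ∧ true) xor b)) xor ((b ∧ a) xor (x · y))
    ≡⟨ collect a b (x · y) ⟩
  (a ∧ b) xor (x · y) ∎
  where
  collect : ∀ a b c → (a ∧ ((b ∧ true) xor b)) xor ((b ∧ a) xor c) ≡ (a ∧ b) xor c
  collect = solve 3 (λ a b c → (a :* ((b :* con true) :+ b)) :+ ((b :* a) :+ c) := (a :* b) :+ c) refl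
    where open xor-∧-Solver

-- §2  Gram–Schmidt

gsStep-cong : ∀ {d} (acc : List (V d)) {b b' : V d} → b ≗ b' → gsStep acc b ≗ gsStep acc b'
gsStep-cong []        b≗b' x = b≗b' x
gsStep-cong (p ∷ acc) b≗b' x =
  cong₂ (λ s t → (p x ∧ s) xor t) (·-cong (λ _ → refl) b≗b') (gsStep-cong acc b≗b' x)

·-gsStep : ∀ {d} (q p : V d) (acc : List (V d)) (b : V d) →
  q · gsStep (p ∷ acc) b ≡ ((p · b) ∧ (q · p)) xor (q · gsStep acc b)
·-gsStep q p acc b =
  trans (·-⊕ʳ q ((p · b) *V p) (gsStep acc b)) (cong (_xor (q · gsStep acc b)) (·-*ʳ q (p · b) p))

gsStep-invisible : ∀ {d} (q : V d) (acc : List (V d)) (b : V d) →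
  All (q ⊥_) acc → q · gsStep acc b ≡ q · b
gsStep-invisible q []        b []             = refl
gsStep-invisible q (p ∷ acc) b (q⊥p ∷ q⊥acc) = begin
  q · gsStep (p ∷ acc) b                       ≡⟨ ·-gsStep q p acc b ⟩
  ((p · b) ∧ (q · p)) xor (q · gsStep acc b)  ≡⟨ cong₂ (λ s t → ((p · b) ∧ s) xor t) q⊥p (gsStep-invisible q acc b q⊥acc) ⟩
  ((p · b) ∧ false) xor (q · b)               ≡⟨ cong (_xor (q · b)) (∧-zeroʳ (p · b)) ⟩
  q · b                                        ∎

Orthonormal : ∀ {d} → List (V d) → Set
Orthonormal []        = ⊤
Orthonormal (p ∷ acc) = Unit p × All (_⊥ p) acc × Orthonormal acc

gsStep-⊥ : ∀ {d} (acc : List (V d)) → Orthonormal acc → (b : V d) → All (_⊥ gsStep acc b) acc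
gsStep-⊥ []        _                          b = []
gsStep-⊥ (p ∷ acc) (p-unit , acc⊥p , acc-on) b = p⊥step ∷ All.zipWith q⊥step (acc⊥p , gsStep-⊥ acc acc-on b)
  where
  p⊥step : p ⊥ gsStep (p ∷ acc) b
  p⊥step = begin
    p · gsStep (p ∷ acc) b                       ≡⟨ ·-gsStep p p acc b ⟩
    ((p · b) ∧ (p · p)) xor (p · gsStep acc b)  ≡⟨ cong₂ (λ s t → ((p · b) ∧ s) xor t) p-unit
                                                      (gsStep-invisible p acc b (All.map (λ {q} → ⊥-sym q p) acc⊥p)) ⟩
    ((p · b) ∧ true) xor (p · b)                ≡⟨ cong (_xor (p · b)) (∧-identityʳ (p · b)) ⟩
    (p · b) xor (p · b)                         ≡⟨ xor-same (p · b) ⟩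
    false                                        ∎
  q⊥step : ∀ {q} → q ⊥ p × q ⊥ gsStep acc b → q ⊥ gsStep (p ∷ acc) b
  q⊥step {q} (q⊥p , q⊥rest) = begin
    q · gsStep (p ∷ acc) b                       ≡⟨ ·-gsStep q p acc b ⟩
    ((p · b) ∧ (q · p)) xor (q · gsStep acc b)  ≡⟨ cong₂ (λ s t → ((p · b) ∧ s) xor t) q⊥p q⊥rest ⟩
    ((p · b) ∧ false) xor false                 ≡⟨ cong (_xor false) (∧-zeroʳ (p · b)) ⟩
    false                                        ∎

module _ {d : ℕ} where

  gsGo-⊥ : ∀ {m} (acc : List (V d)) (cs : Vec (V d) m) → Orthonormal acc →
    VecAll.All Unit (gsGo acc cs) → ∀ k → All (_⊥ lookup (gsGo acc cs) k) acc
  gsGo-⊥ acc (c ∷ cs) acc-on (p-unit ∷ units) zero    = gsStep-⊥ acc acc-on c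
  gsGo-⊥ acc (c ∷ cs) acc-on (p-unit ∷ units) (suc k) =
    All.tail (gsGo-⊥ (gsStep acc c ∷ acc) cs (p-unit , gsStep-⊥ acc acc-on c , acc-on) units k)

  gsGo-orthonormal : ∀ {m} (acc : List (V d)) (cs : Vec (V d) m) → Orthonormal acc →
    VecAll.All Unit (gsGo acc cs) → ∀ i j → lookup (gsGo acc cs) i · lookup (gsGo acc cs) j ≡ (i == j)
  gsGo-orthonormal acc (c ∷ cs) acc-on (p-unit ∷ units) = entry
    where
    p = gsStep acc c
    p∷acc-on : Orthonormal (p ∷ acc)
    p∷acc-on = p-unit , gsStep-⊥ acc acc-on c , acc-on
    rest = gsGo (p ∷ acc) cs
    p⊥rest : ∀ k → p ⊥ lookup rest k
    p⊥rest k = All.head (gsGo-⊥ (p ∷ acc) cs p∷acc-on units k)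
    entry : ∀ i j → lookup (p ∷ rest) i · lookup (p ∷ rest) j ≡ (i == j)
    entry zero    zero    = p-unit
    entry zero    (suc j) = p⊥rest j
    entry (suc i) zero    = ⊥-sym p (lookup rest i) (p⊥rest i)
    entry (suc i) (suc j) = trans (gsGo-orthonormal (p ∷ acc) cs p∷acc-on units i j) (sym (==-suc i j))

-- §3  Orthogonality of ψ(B) over F₂

gsColumns : ∀ {n} → Mat n → Vec (V n) n
gsColumns B = gsGo [] (tabulate (λ k i → B i k))

-- 1̂ᵀ ψ(B) = 1̂ᵀ says that every column of ψ(B) is a unit vector, since x · x
-- is the entry sum of x.
onesLeftEigen⇔units : ∀ {n} (B : Mat n) → OnesLeftEigen (ψ B) ⇔ VecAll.All Unit (gsColumns B)
onesLeftEigen⇔units B = mk⇔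
  (λ ones → lookup⁻ (λ k → trans (·-self (lookup (gsColumns B) k)) (ones k)))
  (λ units k → trans (sym (·-self (lookup (gsColumns B) k))) (lookup⁺ units k))

-- ψ(B) is orthogonal iff its columns are unit vectors: the diagonal of
-- ψ(B)ᵀ ψ(B) demands it, and then Gram–Schmidt makes the columns orthogonal.
orthogonal⇔units : ∀ {n} (B : Mat n) → Orthogonal (ψ B) ⇔ VecAll.All Unit (gsColumns B)
orthogonal⇔units B = mk⇔
  (λ orth → lookup⁻ (λ k → trans (orth k k) (==-refl k)))
  (gsGo-orthonormal [] (tabulate (λ k i → B i k)) tt)

-- §4  Pressing a black vertex is a rank-one update of A(G)

module _ {n : ℕ} (G : BGraph n) where

  augAdj-diag : ∀ i → augAdj G i i ≡ black G i
  augAdj-diag i = cong (λ t → if t then black G i else adj G i i) (==-refl i)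

  augAdj-offdiag : ∀ {i j} → ¬ i ≡ j → augAdj G i j ≡ adj G i j
  augAdj-offdiag {i} {j} i≢j = cong (λ t → if t then black G i else adj G i j) (==-≢ i≢j)

  inN*≡augAdj : ∀ {v} → black G v ≡ true → ∀ i → inN* G v i ≡ augAdj G v i
  inN*≡augAdj {v} bv i = by-diagonal {P = λ i v → black G v ≡ true → inN* G v i ≡ augAdj G v i}
    at-v off-v i v bv
    where
    at-v : ∀ v → black G v ≡ true → inN* G v v ≡ augAdj G v v
    at-v v bv = begin
      (v == v) ∨ adj G v v ≡⟨ cong (_∨ adj G v v) (==-refl v) ⟩
      true                 ≡⟨ sym bv ⟩
      black G v            ≡⟨ sym (augAdj-diag v) ⟩
      augAdj G v v         ∎
    off-v : ∀ {i v} → ¬ i ≡ v → black G v ≡ true → inN* G v i ≡ augAdj G v i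
    off-v {i} {v} i≢v _ = begin
      (i == v) ∨ adj G v i ≡⟨ cong (_∨ adj G v i) (==-≢ i≢v) ⟩
      adj G v i            ≡⟨ sym (augAdj-offdiag (i≢v ∘ sym)) ⟩
      augAdj G v i         ∎

  press-augAdj : ∀ {v} → black G v ≡ true → ∀ i j →
    augAdj (press v G) i j ≡ (augAdj G v i ∧ augAdj G v j) xor augAdj G i j
  press-augAdj {v} bv = by-diagonal on-diagonal off-diagonal
    where
    a : Fin n → Bool
    a = augAdj G v
    on-diagonal : ∀ i → augAdj (press v G) i i ≡ (a i ∧ a i) xor augAdj G i i
    on-diagonal i = begin
      augAdj (press v G) i i      ≡⟨ augAdj-diag′ ⟩
      black G i xor inN* G v i    ≡⟨ cong (black G i xor_) (inN*≡augAdj bv i) ⟩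
      black G i xor a i           ≡⟨ xor-comm (black G i) (a i) ⟩
      a i xor black G i           ≡⟨ cong₂ _xor_ (sym (∧-idem (a i))) (sym (augAdj-diag i)) ⟩
      (a i ∧ a i) xor augAdj G i i ∎
      where
      augAdj-diag′ : augAdj (press v G) i i ≡ black G i xor inN* G v i
      augAdj-diag′ = cong (λ t → if t then black G i xor inN* G v i else adj (press v G) i i) (==-refl i)
    off-diagonal : ∀ {i j} → ¬ i ≡ j → augAdj (press v G) i j ≡ (a i ∧ a j) xor augAdj G i j
    off-diagonal {i} {j} i≢j = begin
      augAdj (press v G) i j
        ≡⟨ cong (λ t → if t then black (press v G) i else adj (press v G) i j) (==-≢ i≢j) ⟩
      adj G i j xor (inN* G v i ∧ (inN* G v j ∧ not (i == j)))
        ≡⟨ cong (λ t → adj G i j xor (inN* G v i ∧ (inN* G v j ∧ not t))) (==-≢ i≢j) ⟩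
      adj G i j xor (inN* G v i ∧ (inN* G v j ∧ true))
        ≡⟨ cong₂ (λ s t → adj G i j xor (s ∧ t)) (inN*≡augAdj bv i) (trans (∧-identityʳ _) (inN*≡augAdj bv j)) ⟩
      adj G i j xor (a i ∧ a j)
        ≡⟨ xor-comm (adj G i j) (a i ∧ a j) ⟩
      (a i ∧ a j) xor adj G i j
        ≡⟨ cong ((a i ∧ a j) xor_) (sym (augAdj-offdiag i≢j)) ⟩
      (a i ∧ a j) xor augAdj G i j ∎

  press-irreflexive : (∀ i → adj G i i ≡ false) → ∀ v i → adj (press v G) i i ≡ false
  press-irreflexive loopless v i = begin
    adj G i i xor (inN* G v i ∧ (inN* G v i ∧ not (i == i)))
      ≡⟨ cong₂ (λ s t → s xor (inN* G v i ∧ (inN* G v i ∧ not t))) (loopless i) (==-refl i) ⟩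
    false xor (inN* G v i ∧ (inN* G v i ∧ false))
      ≡⟨ cong (λ t → inN* G v i ∧ t) (∧-zeroʳ (inN* G v i)) ⟩
    inN* G v i ∧ false
      ≡⟨ ∧-zeroʳ (inN* G v i) ⟩
    false ∎

-- §5  Pressing sequences are Gram–Schmidt runs

-- Fix vectors w u (u a vertex); later w u is row u of L.
module Residuals {n d : ℕ} (w : Fin n → V d) where

  residual : List (V d) → Fin n → V d
  residual acc u = gsStep acc (w u)

  -- The invariant of a run: acc are the outputs so far, G is the graph
  -- obtained by pressing the corresponding vertices, and s are the
  -- vertices still to be pressed.
  record Represents (G : BGraph n) (acc : List (V d)) (s : List (Fin n)) : Set where
    field
      orthonormal : Orthonormal acc
      gram        : ∀ i j → augAdj G i j ≡ residual acc i · residual acc j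
      loopless    : ∀ i → adj G i i ≡ false
      pending     : ∀ u → u ∈ s ⊎ residual acc u ≗ 𝟘

  residual-norm : ∀ {G acc s} → Represents G acc s → ∀ {v p} → p ≗ residual acc v → p · p ≡ black G v
  residual-norm {G} rep {v} p≗rv =
    trans (·-cong p≗rv p≗rv) (trans (sym (Represents.gram rep v v)) (augAdj-diag G v))

  -- Pressing the black vertex v corresponds to appending its residual p
  -- to the outputs: projecting away p performs the rank-one update of §4.
  press-represents : ∀ {G acc v s} (p : V d) → Represents G acc (v ∷ s) → black G v ≡ true →
    p ≗ residual acc v → Represents (press v G) (p ∷ acc) s
  press-represents {G} {acc} {v} {s} p rep bv p≗rv = record
    { orthonormal = p-unit , acc⊥p , orthonormal
    ; gram        = gram′
    ; loopless    = press-irreflexive G loopless v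
    ; pending     = pending′
    }
    where
    open Represents rep
    a : Fin n → Bool
    a = augAdj G v
    r : Fin n → V d
    r = residual acc
    p-unit : Unit p
    p-unit = trans (residual-norm rep p≗rv) bv
    acc⊥p : All (_⊥ p) acc
    acc⊥p = All.map (λ {q} q⊥rv → trans (·-cong (λ _ → refl) p≗rv) q⊥rv) (gsStep-⊥ acc orthonormal (w v))
    p·r : ∀ u → p · r u ≡ a u
    p·r u = trans (·-cong p≗rv (λ _ → refl)) (sym (gram v u))
    p·w : ∀ u → p · w u ≡ a u
    p·w u = trans (sym (gsStep-invisible p acc (w u) (All.map (λ {q} → ⊥-sym q p) acc⊥p))) (p·r u)
    residual-update : ∀ u → residual (p ∷ acc) u ≗ (a u *V p) ⊕ r u
    residual-update u x = cong (λ t → (p x ∧ t) xor r u x) (p·w u)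
    gram′ : ∀ i j → augAdj (press v G) i j ≡ residual (p ∷ acc) i · residual (p ∷ acc) j
    gram′ i j = begin
      augAdj (press v G) i j                   ≡⟨ press-augAdj G bv i j ⟩
      (a i ∧ a j) xor augAdj G i j             ≡⟨ cong ((a i ∧ a j) xor_) (gram i j) ⟩
      (a i ∧ a j) xor (r i · r j)              ≡⟨ sym (·-rank-one p (r i) (r j) p-unit
                                                      (trans (·-comm (r i) p) (p·r i)) (p·r j)) ⟩
      ((a i *V p) ⊕ r i) · ((a j *V p) ⊕ r j)  ≡⟨ sym (·-cong (residual-update i) (residual-update j)) ⟩
      residual (p ∷ acc) i · residual (p ∷ acc) j ∎
    pending′ : ∀ u → u ∈ s ⊎ residual (p ∷ acc) u ≗ 𝟘
    pending′ u with pending u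
    ... | inj₁ (here refl) = inj₂ λ x → begin
      residual (p ∷ acc) v x   ≡⟨ residual-update v x ⟩
      (p x ∧ a v) xor r v x    ≡⟨ cong₂ (λ s t → (p x ∧ s) xor t) (trans (augAdj-diag G v) bv) (sym (p≗rv x)) ⟩
      (p x ∧ true) xor p x     ≡⟨ cong (_xor p x) (∧-identityʳ (p x)) ⟩
      p x xor p x              ≡⟨ xor-same (p x) ⟩
      false                    ∎
    ... | inj₁ (there u∈s) = inj₁ u∈s
    ... | inj₂ ru≗𝟘        = inj₂ λ x → begin
      residual (p ∷ acc) u x   ≡⟨ residual-update u x ⟩
      (p x ∧ a u) xor r u x    ≡⟨ cong₂ (λ s t → (p x ∧ s) xor t) (trans (sym (p·r u)) (·-zeroʳ p ru≗𝟘)) (ru≗𝟘 x) ⟩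
      (p x ∧ false) xor false  ≡⟨ cong (_xor false) (∧-zeroʳ (p x)) ⟩
      false                    ∎

  -- When nothing is left to press, all residuals vanish, so A(G) = 0.
  represents-done : ∀ {G acc} → Represents G acc [] → SuccessfulPressing G []
  represents-done {G} {acc} rep = adj-zero , black-zero
    where
    open Represents rep
    residual-zero : ∀ u → residual acc u ≗ 𝟘
    residual-zero u with pending u
    ... | inj₂ ru≗𝟘 = ru≗𝟘
    augAdj-zero : ∀ i j → augAdj G i j ≡ false
    augAdj-zero i j = trans (gram i j) (·-zeroʳ (residual acc i) (residual-zero j))
    adj-zero : ∀ i j → adj G i j ≡ false
    adj-zero = by-diagonal loopless (λ {i} {j} i≢j → trans (sym (augAdj-offdiag G i≢j)) (augAdj-zero i j))
    black-zero : ∀ i → black G i ≡ false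
    black-zero i = trans (sym (augAdj-diag G i)) (augAdj-zero i i)

  data Columns : ∀ {m} → List (Fin n) → Vec (V d) m → Set where
    []  : Columns [] []
    _∷_ : ∀ {m v s c} {cs : Vec (V d) m} → c ≗ w v → Columns s cs → Columns (v ∷ s) (c ∷ cs)

  pressing⇔units : ∀ {G acc s m} {cs : Vec (V d) m} → Represents G acc s → Columns s cs →
    SuccessfulPressing G s ⇔ VecAll.All Unit (gsGo acc cs)
  pressing⇔units rep [] = mk⇔ (λ _ → []) (λ _ → represents-done rep)
  pressing⇔units {G} {acc} {v ∷ s} {cs = c ∷ cs} rep (c≗wv ∷ cols) = mk⇔ to from
    where
    p = gsStep acc c
    p≗rv : p ≗ residual acc v
    p≗rv = gsStep-cong acc c≗wv
    p-norm : p · p ≡ black G v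
    p-norm = residual-norm rep p≗rv
    rest : black G v ≡ true → SuccessfulPressing (press v G) s ⇔ VecAll.All Unit (gsGo (p ∷ acc) cs)
    rest bv = pressing⇔units (press-represents p rep bv p≗rv) cols
    to : SuccessfulPressing G (v ∷ s) → VecAll.All Unit (gsGo acc (c ∷ cs))
    to (bv , success) = trans p-norm bv ∷ Equivalence.to (rest bv) success
    from : VecAll.All Unit (gsGo acc (c ∷ cs)) → SuccessfulPressing G (v ∷ s)
    from (p-unit ∷ units) = bv , Equivalence.from (rest bv) units
      where
      bv : black G v ≡ true
      bv = trans (sym p-norm) p-unit

  columns-tabulate : ∀ {m} (f : Fin m → Fin n) (g : Fin m → V d) →
    (∀ k → g k ≗ w (f k)) → Columns (List.tabulate f) (tabulate g)
  columns-tabulate {zero}  f g g≗wf = []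
  columns-tabulate {suc m} f g g≗wf = g≗wf zero ∷ columns-tabulate (f ∘ suc) (g ∘ suc) (g≗wf ∘ suc)

-- §6  The theorem

column-LᵀPᵀ : ∀ {n} (L : Mat n) (σ : Permutation′ n) (k : Fin n) →
  (λ i → ((L ᵀ) *M (permMat σ ᵀ)) i k) ≗ L (σ ⟨$⟩ʳ k)
column-LᵀPᵀ L σ k i = Σ₂-select (λ l → L l i) (σ ⟨$⟩ʳ k)

σ-covers : ∀ {n} (σ : Permutation′ n) (u : Fin n) → u ∈ map (σ ⟨$⟩ʳ_) (allFin n)
σ-covers σ u = subst (_∈ map (σ ⟨$⟩ʳ_) (allFin _)) (inverseʳ σ) (∈-map⁺ (σ ⟨$⟩ʳ_) (∈-allFin (σ ⟨$⟩ˡ u)))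

proposition6 : (n : ℕ) (G : BGraph n) → Simple G →
    SuccessfulPressing G (allFin n) →
    (L : Mat n) → LowerTriangular L → Invertible L → augAdj G ≈M (L *M (L ᵀ)) →
    (σ : Permutation′ n) →
    (SuccessfulPressing G (map (σ ⟨$⟩ʳ_) (allFin n)) ⇔ OnesLeftEigen (ψ ((L ᵀ) *M (permMat σ ᵀ))))
    × (SuccessfulPressing G (map (σ ⟨$⟩ʳ_) (allFin n)) ⇔ Orthogonal (ψ ((L ᵀ) *M (permMat σ ᵀ))))
proposition6 n G (_ , loopless) _ L _ _ A≈LLᵀ σ =
  ⇔.trans success⇔units (⇔.sym (onesLeftEigen⇔units B)) ,
  ⇔.trans success⇔units (⇔.sym (orthogonal⇔units B))
  where
  open Residuals L
  order : List (Fin n)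
  order = map (σ ⟨$⟩ʳ_) (allFin n)
  B : Mat n
  B = (L ᵀ) *M (permMat σ ᵀ)
  -- Before any press, the residuals are the rows of L, with Gram matrix A(G).
  start : Represents G [] order
  start = record { orthonormal = tt ; gram = A≈LLᵀ ; loopless = loopless ; pending = inj₁ ∘ σ-covers σ }
  columns : Columns order (tabulate (λ k i → B i k))
  columns = subst (λ t → Columns t (tabulate (λ k i → B i k))) (sym (map-tabulate (λ k → k) (σ ⟨$⟩ʳ_)))
                  (columns-tabulate (σ ⟨$⟩ʳ_) (λ k i → B i k) (column-LᵀPᵀ L σ))
  success⇔units : SuccessfulPressing G order ⇔ VecAll.All Unit (gsColumns B)
  success⇔units = pressing⇔units start columns
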